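{- Define polynomials $Q_n(x)$ and $\widehat{Q}_n(x)$ by $\frac{\mathrm{d}^n}{\mathrm{d}\theta^n}\tan\theta=Q_n(\tan\theta)$ and $\frac{\mathrm{d}^n}{\mathrm{d}\theta^n}\sec\theta=\sec\theta\cdot\widehat{Q}_n(\tan\theta)$. Then for every $n\geqslant1$, $$Q_{2n-1}(x)=\sum_{j=1}^{n}(-4)^{n-j}(2j-1)!\,U(n,j)(1+x^2)^j,\qquad Q_{2n}(x)=x\sum_{j=1}^{n}(-4)^{n-j}(2j)!\,U(n,j)(1+x^2)^j,$$ $$\widehat{Q}_{2n}(x)=\sum_{j=0}^{n}(-1)^{n-j}(2j)!\,V(n,j)(1+x^2)^j,\qquad \widehat{Q}_{2n+1}(x)=x\sum_{j=0}^{n}(-1)^{n-j}(2j+1)!\,V(n,j)(1+x^2)^j.$$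
   Context: Equivalently $Q_0(x)=x$, $Q_{n+1}(x)=(1+x^2)Q_n'(x)$, $\widehat{Q}_0(x)=1$, $\widehat{Q}_{n+1}(x)=(1+x^2)\widehat{Q}_n'(x)+x\widehat{Q}_n(x)$. The numbers $U(n,k)$ ($n\geqslant1$) are defined by $U(1,1)=1$, $U(1,k)=0$ for $k\neq1$, $U(n,k)=U(n-1,k-1)+k^2U(n-1,k)$. The numbers $V(n,k)$ ($n,k\geqslant0$) are defined by $V(0,0)=1$, $V(0,k)=0$ for $k\neq0$, $V(n,k)=V(n-1,k-1)+(2k+1)^2V(n-1,k)$. -}

module Defs where

open import Data.Nat as ℕ using (ℕ; zero; suc; _∸_; _!)
open import Data.Integer as ℤ using (ℤ; +_; -[1+_]; _+_; _*_; _^_)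
open import Relation.Binary.PropositionalEquality using (_≡_)

-- Polynomials with integer coefficients, represented by their coefficient
-- sequence: p k is the coefficient of x^k.  (All polynomials built below
-- have finite support.)  Equality of polynomials = equality of all coefficients.
Poly : Set
Poly = ℕ → ℤ

_≋_ : Poly → Poly → Set
p ≋ q = ∀ k → p k ≡ q k

infix 4 _≋_

zeroP : Poly
zeroP _ = + 0

oneP : Poly
oneP zero    = + 1
oneP (suc _) = + 0

X : Poly
X (suc zero) = + 1
X _          = + 0

onePlusX² : Poly
onePlusX² zero             = + 1
onePlusX² (suc (suc zero)) = + 1
onePlusX² _                = + 0

_⊕_ : Poly → Poly → Poly
(p ⊕ q) k = p k + q k

_·_ : ℤ → Poly → Poly
(c · p) k = c * p k

convAux : Poly → Poly → ℕ → ℕ → ℤ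
convAux a b k zero    = a zero * b k
convAux a b k (suc i) = convAux a b k i + a (suc i) * b (k ∸ suc i)

_⊗_ : Poly → Poly → Poly
(a ⊗ b) k = convAux a b k k

_^P_ : Poly → ℕ → Poly
p ^P zero  = oneP
p ^P suc j = p ⊗ (p ^P j)

deriv : Poly → Poly
deriv p k = + suc k * p (suc k)

Q : ℕ → Poly
Q zero    = X
Q (suc n) = onePlusX² ⊗ deriv (Q n)

Q̂ : ℕ → Poly
Q̂ zero    = oneP
Q̂ (suc n) = (onePlusX² ⊗ deriv (Q̂ n)) ⊕ (X ⊗ Q̂ n)

-- U(n,k), meaningful for n ≥ 1: U(1,1)=1, U(1,k)=0 (k≠1),
-- U(n,k) = U(n-1,k-1) + k^2 U(n-1,k)  (with U(n-1,-1) = 0).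
-- U 0 k is never used (set to 0).
U : ℕ → ℕ → ℕ
U zero _                      = 0
U (suc zero) (suc zero)       = 1
U (suc zero) _                = 0
U (suc (suc n)) zero          = 0 ℕ.* U (suc n) zero
U (suc (suc n)) (suc k)       = U (suc n) k ℕ.+ (suc k ℕ.* suc k) ℕ.* U (suc n) (suc k)

V : ℕ → ℕ → ℕ
V zero zero          = 1
V zero (suc _)       = 0
V (suc n) zero       = (1 ℕ.* 1) ℕ.* V n zero
V (suc n) (suc k)    = V n k ℕ.+ (ℕ.suc (2 ℕ.* suc k) ℕ.* ℕ.suc (2 ℕ.* suc k)) ℕ.* V n (suc k)

sum₁ : ℕ → (ℕ → Poly) → Poly
sum₁ zero    f = zeroP
sum₁ (suc n) f = sum₁ n f ⊕ f (suc n)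

sum₀ : ℕ → (ℕ → Poly) → Poly
sum₀ zero    f = f zero
sum₀ (suc n) f = sum₀ n f ⊕ f (suc n)

-4ℤ -1ℤ : ℤ
-4ℤ = -[1+ 3 ]
-1ℤ = -[1+ 0 ]

-- With 𝒟 a f := (1 + x²) f′ + a x f we have Q_{k+1} = 𝒟 0 Q_k and Q̂_{k+1} = 𝒟 1 Q̂_k.
-- Since (1 + x²) ((1 + x²)^j)′ = 2j x (1 + x²)^j and x² = (1 + x²) − 1, the operator 𝒟 a maps
--   Σ β_j (1 + x²)^j     to   x Σ (a + 2j) β_j (1 + x²)^j,
--   x Σ β_j (1 + x²)^j   to   Σ ((a + 2j − 1) β_{j−1} − (a + 2j) β_j) (1 + x²)^j.
-- Hence Q and Q̂ alternate between these two shapes, and the stated coefficients obey the resulting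
-- recurrences precisely because of the recurrences defining U and V: the extra factor −(2j)² = (−4) j²
-- (resp. −(2j+1)² = (−1)(2j+1)²) is absorbed by one more power of −4 (resp. −1).

module Submission where

open import Defs
open import Data.Nat using (ℕ; _≤_; _∸_; _!)
open import Data.Nat as N using ()
open import Data.Integer using (+_; _*_; _^_)
open import Data.Product using (_×_)

open import Data.Integer using (ℤ; _+_; _-_; -_)
import Data.Integer.Properties as ZP
open import Data.Integer.Tactic.RingSolver using (solve-∀; solve)
open import Data.List using (_∷_; [])
open import Data.Nat using (zero; suc; _<_; s≤s; z≤n)
import Data.Nat.Properties as NP
open import Data.Product using (_,_)
open import Function using (_∘_)
open import Relation.Binary.PropositionalEquality
import Relation.Binary.Reasoning.Setoid as SetoidReasoning
open import Algebra.Properties.CommutativeSemigroup ZP.+-commutativeSemigroup using (interchange)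
open import Algebra.Properties.CommutativeSemigroup ZP.*-commutativeSemigroup using (x∙yz≈y∙xz)

module ≋-Reasoning = SetoidReasoning (ℕ →-setoid ℤ)

≋-refl : ∀ {p} → p ≋ p
≋-refl k = refl

≋-sym : ∀ {p q} → p ≋ q → q ≋ p
≋-sym p≋q k = sym (p≋q k)

≋-trans : ∀ {p q r} → p ≋ q → q ≋ r → p ≋ r
≋-trans p≋q q≋r k = trans (p≋q k) (q≋r k)

mulX : Poly → Poly
mulX p zero    = + 0
mulX p (suc k) = p k

mulOnePlusX² : Poly → Poly
mulOnePlusX² p = p ⊕ mulX (mulX p)

⊕-cong : ∀ {p p′ q q′} → p ≋ p′ → q ≋ q′ → p ⊕ q ≋ p′ ⊕ q′
⊕-cong p≋p′ q≋q′ k = cong₂ _+_ (p≋p′ k) (q≋q′ k)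

⊕-congˡ : ∀ {p p′} q → p ≋ p′ → p ⊕ q ≋ p′ ⊕ q
⊕-congˡ q p≋p′ k = cong (_+ q k) (p≋p′ k)

⊕-congʳ : ∀ p {q q′} → q ≋ q′ → p ⊕ q ≋ p ⊕ q′
⊕-congʳ p q≋q′ k = cong (_+_ (p k)) (q≋q′ k)

·-congʳ : ∀ c {p q} → p ≋ q → c · p ≋ c · q
·-congʳ c p≋q k = cong (c *_) (p≋q k)

·-congˡ : ∀ {c d} p → c ≡ d → c · p ≋ d · p
·-congˡ p refl = ≋-refl

mulX-cong : ∀ {p q} → p ≋ q → mulX p ≋ mulX q
mulX-cong p≋q zero    = refl
mulX-cong p≋q (suc k) = p≋q k

mulOnePlusX²-cong : ∀ {p q} → p ≋ q → mulOnePlusX² p ≋ mulOnePlusX² q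
mulOnePlusX²-cong p≋q = ⊕-cong p≋q (mulX-cong (mulX-cong p≋q))

deriv-cong : ∀ {p q} → p ≋ q → deriv p ≋ deriv q
deriv-cong p≋q k = cong (+ suc k *_) (p≋q (suc k))

X⊗≋mulX : ∀ p → X ⊗ p ≋ mulX p
X⊗≋mulX p zero    = refl
X⊗≋mulX p (suc k) = convAux-X k
  where
  convAux-X : ∀ i → convAux X p (suc k) (suc i) ≡ p k
  convAux-X zero    = trans (ZP.+-identityˡ _) (ZP.*-identityˡ (p k))
  convAux-X (suc i) = trans (ZP.+-identityʳ _) (convAux-X i)

onePlusX²⊗≋mulOnePlusX² : ∀ p → onePlusX² ⊗ p ≋ mulOnePlusX² p
onePlusX²⊗≋mulOnePlusX² p zero          = trans (ZP.*-identityˡ (p 0)) (sym (ZP.+-identityʳ (p 0)))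
onePlusX²⊗≋mulOnePlusX² p (suc zero)    = cong (_+ _) (ZP.*-identityˡ (p 1))
onePlusX²⊗≋mulOnePlusX² p (suc (suc k)) = convAux-onePlusX² k
  where
  convAux-onePlusX² : ∀ i → convAux onePlusX² p (suc (suc k)) (suc (suc i)) ≡ p (suc (suc k)) + p k
  convAux-onePlusX² zero    =
    cong₂ _+_ (trans (ZP.+-identityʳ (+ 1 * p (suc (suc k)))) (ZP.*-identityˡ _)) (ZP.*-identityˡ (p k))
  convAux-onePlusX² (suc i) = trans (ZP.+-identityʳ _) (convAux-onePlusX² i)

⊕-assoc : ∀ p q r → (p ⊕ q) ⊕ r ≋ p ⊕ (q ⊕ r)
⊕-assoc p q r k = ZP.+-assoc (p k) (q k) (r k)

⊕-interchange : ∀ p q r s → (p ⊕ q) ⊕ (r ⊕ s) ≋ (p ⊕ r) ⊕ (q ⊕ s)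
⊕-interchange p q r s k = interchange (p k) (q k) (r k) (s k)

·-distribˡ-⊕ : ∀ c p q → c · (p ⊕ q) ≋ (c · p) ⊕ (c · q)
·-distribˡ-⊕ c p q k = ZP.*-distribˡ-+ c (p k) (q k)

·-distribʳ-+ : ∀ a b p → (a · p) ⊕ (b · p) ≋ (a + b) · p
·-distribʳ-+ a b p k = sym (ZP.*-distribʳ-+ (p k) a b)

·-assoc : ∀ a b p → a · (b · p) ≋ (a * b) · p
·-assoc a b p k = sym (ZP.*-assoc a b (p k))

mulX-⊕ : ∀ p q → mulX (p ⊕ q) ≋ mulX p ⊕ mulX q
mulX-⊕ p q zero    = refl
mulX-⊕ p q (suc k) = refl

mulX-· : ∀ c p → mulX (c · p) ≋ c · mulX p
mulX-· c p zero    = sym (ZP.*-zeroʳ c)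
mulX-· c p (suc k) = refl

mulOnePlusX²-⊕ : ∀ p q → mulOnePlusX² (p ⊕ q) ≋ mulOnePlusX² p ⊕ mulOnePlusX² q
mulOnePlusX²-⊕ p q = ≋-trans
  (⊕-congʳ (p ⊕ q) (≋-trans (mulX-cong (mulX-⊕ p q)) (mulX-⊕ (mulX p) (mulX q))))
  (⊕-interchange p q (mulX (mulX p)) (mulX (mulX q)))

mulOnePlusX²-· : ∀ c p → mulOnePlusX² (c · p) ≋ c · mulOnePlusX² p
mulOnePlusX²-· c p = ≋-trans
  (⊕-congʳ (c · p) (≋-trans (mulX-cong (mulX-· c p)) (mulX-· c (mulX p))))
  (≋-sym (·-distribˡ-⊕ c p (mulX (mulX p))))

mulOnePlusX²-mulX : ∀ p → mulOnePlusX² (mulX p) ≋ mulX (mulOnePlusX² p)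
mulOnePlusX²-mulX p zero    = refl
mulOnePlusX²-mulX p (suc k) = refl

deriv-⊕ : ∀ p q → deriv (p ⊕ q) ≋ deriv p ⊕ deriv q
deriv-⊕ p q k = ZP.*-distribˡ-+ (+ suc k) (p (suc k)) (q (suc k))

deriv-· : ∀ c p → deriv (c · p) ≋ c · deriv p
deriv-· c p k = x∙yz≈y∙xz (+ suc k) c (p (suc k))

deriv-mulX : ∀ p → deriv (mulX p) ≋ p ⊕ mulX (deriv p)
deriv-mulX p zero    = trans (ZP.*-identityˡ (p 0)) (sym (ZP.+-identityʳ (p 0)))
deriv-mulX p (suc k) = trans (ZP.*-distribʳ-+ (p (suc k)) (+ 1) (+ suc k))
                             (cong (_+ + suc k * p (suc k)) (ZP.*-identityˡ (p (suc k))))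

deriv-mulOnePlusX² : ∀ p → deriv (mulOnePlusX² p) ≋ mulOnePlusX² (deriv p) ⊕ ((+ 2) · mulX p)
deriv-mulOnePlusX² p = begin
  deriv (p ⊕ mulX (mulX p))
    ≈⟨ deriv-⊕ p (mulX (mulX p)) ⟩
  deriv p ⊕ deriv (mulX (mulX p))
    ≈⟨ ⊕-congʳ (deriv p) (deriv-mulX (mulX p)) ⟩
  deriv p ⊕ (mulX p ⊕ mulX (deriv (mulX p)))
    ≈⟨ ⊕-congʳ (deriv p) (⊕-congʳ (mulX p) (≋-trans (mulX-cong (deriv-mulX p)) (mulX-⊕ p (mulX (deriv p))))) ⟩
  deriv p ⊕ (mulX p ⊕ (mulX p ⊕ mulX (mulX (deriv p))))
    ≈⟨ (λ k → regroup (deriv p k) (mulX p k) (mulX (mulX (deriv p)) k)) ⟩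
  mulOnePlusX² (deriv p) ⊕ ((+ 2) · mulX p) ∎
  where
  open ≋-Reasoning
  regroup : ∀ a b c → a + (b + (b + c)) ≡ (a + c) + + 2 * b
  regroup = solve-∀

mulOnePlusX²-deriv-^P : ∀ j → mulOnePlusX² (deriv (onePlusX² ^P j)) ≋ (+ (2 N.* j)) · mulX (onePlusX² ^P j)
mulOnePlusX²-deriv-^P zero zero          = refl
mulOnePlusX²-deriv-^P zero (suc zero)    = refl
mulOnePlusX²-deriv-^P zero (suc (suc k)) = cong₂ _+_ (ZP.*-zeroʳ (+ suc (suc (suc k)))) (ZP.*-zeroʳ (+ suc k))
mulOnePlusX²-deriv-^P (suc j) = begin
  mulOnePlusX² (deriv (onePlusX² ⊗ P))
    ≈⟨ mulOnePlusX²-cong (≋-trans (deriv-cong (onePlusX²⊗≋mulOnePlusX² P)) (deriv-mulOnePlusX² P)) ⟩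
  mulOnePlusX² (mulOnePlusX² (deriv P) ⊕ ((+ 2) · mulX P))
    ≈⟨ mulOnePlusX²-⊕ (mulOnePlusX² (deriv P)) ((+ 2) · mulX P) ⟩
  mulOnePlusX² (mulOnePlusX² (deriv P)) ⊕ mulOnePlusX² ((+ 2) · mulX P)
    ≈⟨ ⊕-cong (≋-trans (mulOnePlusX²-cong (mulOnePlusX²-deriv-^P j)) (mulOnePlusX²-· (+ (2 N.* j)) (mulX P)))
              (mulOnePlusX²-· (+ 2) (mulX P)) ⟩
  ((+ (2 N.* j)) · mulOnePlusX² (mulX P)) ⊕ ((+ 2) · mulOnePlusX² (mulX P))
    ≈⟨ ·-distribʳ-+ (+ (2 N.* j)) (+ 2) (mulOnePlusX² (mulX P)) ⟩
  (+ (2 N.* j) + + 2) · mulOnePlusX² (mulX P)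
    ≈⟨ ·-congʳ (+ (2 N.* j) + + 2)
               (≋-trans (mulOnePlusX²-mulX P) (mulX-cong (≋-sym (onePlusX²⊗≋mulOnePlusX² P)))) ⟩
  (+ (2 N.* j) + + 2) · mulX (onePlusX² ⊗ P)
    ≈⟨ ·-congˡ (mulX (onePlusX² ⊗ P)) (cong +_ (trans (NP.+-comm (2 N.* j) 2) (sym (NP.*-suc 2 j)))) ⟩
  (+ (2 N.* suc j)) · mulX (onePlusX² ⊗ P) ∎
  where
  open ≋-Reasoning
  P : Poly
  P = onePlusX² ^P j

sum₀-cong : ∀ n {f g : ℕ → Poly} → (∀ j → f j ≋ g j) → sum₀ n f ≋ sum₀ n g
sum₀-cong zero    f≋g = f≋g 0
sum₀-cong (suc n) f≋g = ⊕-cong (sum₀-cong n f≋g) (f≋g (suc n))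

sum₀-map : (L : Poly → Poly) → (∀ {p q} → p ≋ q → L p ≋ L q) → (∀ p q → L (p ⊕ q) ≋ L p ⊕ L q) →
           ∀ n f → L (sum₀ n f) ≋ sum₀ n (λ j → L (f j))
sum₀-map L L-cong L-⊕ zero    f = ≋-refl
sum₀-map L L-cong L-⊕ (suc n) f =
  ≋-trans (L-⊕ (sum₀ n f) (f (suc n))) (⊕-congˡ (L (f (suc n))) (sum₀-map L L-cong L-⊕ n f))

sum₀-⊕ : ∀ n f g → sum₀ n f ⊕ sum₀ n g ≋ sum₀ n (λ j → f j ⊕ g j)
sum₀-⊕ zero    f g = ≋-refl
sum₀-⊕ (suc n) f g = ≋-trans
  (⊕-interchange (sum₀ n f) (f (suc n)) (sum₀ n g) (g (suc n)))
  (⊕-congˡ (f (suc n) ⊕ g (suc n)) (sum₀-⊕ n f g))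

powSum : (ℕ → ℤ) → ℕ → Poly
powSum β n = sum₀ n (λ j → β j · (onePlusX² ^P j))

powSum-cong : ∀ n {β γ} → (∀ j → β j ≡ γ j) → powSum β n ≋ powSum γ n
powSum-cong n β≡γ = sum₀-cong n (λ j → ·-congˡ (onePlusX² ^P j) (β≡γ j))

powSum-⊕ : ∀ β γ n → powSum β n ⊕ powSum γ n ≋ powSum (λ j → β j + γ j) n
powSum-⊕ β γ n = ≋-trans (sum₀-⊕ n _ _) (sum₀-cong n (λ j → ·-distribʳ-+ (β j) (γ j) (onePlusX² ^P j)))

powSum-· : ∀ c β n → c · powSum β n ≋ powSum (λ j → c * β j) n
powSum-· c β n = ≋-trans (sum₀-map (c ·_) (·-congʳ c) (·-distribˡ-⊕ c) n _)
                         (sum₀-cong n (λ j → ·-assoc c (β j) (onePlusX² ^P j)))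

powSum-extend : ∀ β n → β (suc n) ≡ + 0 → powSum β n ≋ powSum β (suc n)
powSum-extend β n βₙ₊₁≡0 k = trans (sym (ZP.+-identityʳ (powSum β n k)))
  (cong (λ c → powSum β n k + c * (onePlusX² ^P suc n) k) (sym βₙ₊₁≡0))

prev : (ℕ → ℤ) → ℕ → ℤ
prev β zero    = + 0
prev β (suc j) = β j

mulOnePlusX²-·^P : ∀ c j → mulOnePlusX² (c · (onePlusX² ^P j)) ≋ c · (onePlusX² ^P suc j)
mulOnePlusX²-·^P c j = ≋-trans (mulOnePlusX²-· c _) (·-congʳ c (≋-sym (onePlusX²⊗≋mulOnePlusX² _)))

mulOnePlusX²-powSum : ∀ β n → mulOnePlusX² (powSum β n) ≋ powSum (prev β) (suc n)
mulOnePlusX²-powSum β zero    = ≋-trans (mulOnePlusX²-·^P (β 0) 0) (λ k → sym (ZP.+-identityˡ _))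
mulOnePlusX²-powSum β (suc n) = ≋-trans (mulOnePlusX²-⊕ (powSum β n) _)
  (⊕-cong (mulOnePlusX²-powSum β n) (mulOnePlusX²-·^P (β (suc n)) (suc n)))

mulX²-powSum : ∀ β n → β (suc n) ≡ + 0 → mulX (mulX (powSum β n)) ≋ powSum (λ j → prev β j - β j) (suc n)
mulX²-powSum β n βₙ₊₁≡0 = begin
  mulX (mulX (powSum β n))
    ≈⟨ mulX²≋ (powSum β n) ⟩
  mulOnePlusX² (powSum β n) ⊕ (-1ℤ · powSum β n)
    ≈⟨ ⊕-cong (mulOnePlusX²-powSum β n) (·-congʳ -1ℤ (powSum-extend β n βₙ₊₁≡0)) ⟩
  powSum (prev β) (suc n) ⊕ (-1ℤ · powSum β (suc n))
    ≈⟨ ⊕-congʳ (powSum (prev β) (suc n)) (powSum-· -1ℤ β (suc n)) ⟩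
  powSum (prev β) (suc n) ⊕ powSum (λ j → -1ℤ * β j) (suc n)
    ≈⟨ powSum-⊕ (prev β) _ (suc n) ⟩
  powSum (λ j → prev β j + -1ℤ * β j) (suc n)
    ≈⟨ powSum-cong (suc n) (λ j → cong (_+_ (prev β j)) (ZP.-1*i≡-i (β j))) ⟩
  powSum (λ j → prev β j - β j) (suc n) ∎
  where
  open ≋-Reasoning
  mulX²≋ : ∀ p → mulX (mulX p) ≋ mulOnePlusX² p ⊕ (-1ℤ · p)
  mulX²≋ p k = cancel (p k) (mulX (mulX p) k)
    where
    cancel : ∀ a b → b ≡ (a + b) + (- + 1) * a
    cancel = solve-∀

mulOnePlusX²-deriv-powSum : ∀ β n →
  mulOnePlusX² (deriv (powSum β n)) ≋ mulX (powSum (λ j → + (2 N.* j) * β j) n)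
mulOnePlusX²-deriv-powSum β n = begin
  mulOnePlusX² (deriv (powSum β n))
    ≈⟨ mulOnePlusX²-cong (sum₀-map deriv deriv-cong deriv-⊕ n _) ⟩
  mulOnePlusX² (sum₀ n (λ j → deriv (β j · (onePlusX² ^P j))))
    ≈⟨ sum₀-map mulOnePlusX² mulOnePlusX²-cong mulOnePlusX²-⊕ n _ ⟩
  sum₀ n (λ j → mulOnePlusX² (deriv (β j · (onePlusX² ^P j))))
    ≈⟨ sum₀-cong n term ⟩
  sum₀ n (λ j → mulX ((+ (2 N.* j) * β j) · (onePlusX² ^P j)))
    ≈⟨ sum₀-map mulX mulX-cong mulX-⊕ n _ ⟨
  mulX (powSum (λ j → + (2 N.* j) * β j) n) ∎
  where
  open ≋-Reasoning
  term : ∀ j → mulOnePlusX² (deriv (β j · (onePlusX² ^P j))) ≋ mulX ((+ (2 N.* j) * β j) · (onePlusX² ^P j))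
  term j = begin
    mulOnePlusX² (deriv (β j · P))           ≈⟨ mulOnePlusX²-cong (deriv-· (β j) P) ⟩
    mulOnePlusX² (β j · deriv P)             ≈⟨ mulOnePlusX²-· (β j) (deriv P) ⟩
    β j · mulOnePlusX² (deriv P)             ≈⟨ ·-congʳ (β j) (mulOnePlusX²-deriv-^P j) ⟩
    β j · ((+ (2 N.* j)) · mulX P)           ≈⟨ (λ k → x∙yz≈y∙xz (β j) (+ (2 N.* j)) (mulX P k)) ⟩
    (+ (2 N.* j)) · (β j · mulX P)           ≈⟨ ·-assoc (+ (2 N.* j)) (β j) (mulX P) ⟩
    (+ (2 N.* j) * β j) · mulX P             ≈⟨ mulX-· (+ (2 N.* j) * β j) P ⟨
    mulX ((+ (2 N.* j) * β j) · P)           ∎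
    where
    P : Poly
    P = onePlusX² ^P j

-- d/dθ (sec^a θ · f (tan θ)) = sec^a θ · (𝒟 a f) (tan θ).
𝒟 : ℤ → Poly → Poly
𝒟 a f = mulOnePlusX² (deriv f) ⊕ (a · mulX f)

𝒟-cong : ∀ a {f g} → f ≋ g → 𝒟 a f ≋ 𝒟 a g
𝒟-cong a f≋g = ⊕-cong (mulOnePlusX²-cong (deriv-cong f≋g)) (·-congʳ a (mulX-cong f≋g))

𝒟-mulX : ∀ a f → 𝒟 a (mulX f) ≋ mulOnePlusX² f ⊕ mulX (𝒟 a f)
𝒟-mulX a f = begin
  mulOnePlusX² (deriv (mulX f)) ⊕ (a · mulX (mulX f))
    ≈⟨ ⊕-cong (≋-trans (mulOnePlusX²-cong (deriv-mulX f)) (mulOnePlusX²-⊕ f (mulX (deriv f))))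
              (≋-sym (mulX-· a (mulX f))) ⟩
  (mulOnePlusX² f ⊕ mulOnePlusX² (mulX (deriv f))) ⊕ mulX (a · mulX f)
    ≈⟨ ⊕-assoc (mulOnePlusX² f) _ _ ⟩
  mulOnePlusX² f ⊕ (mulOnePlusX² (mulX (deriv f)) ⊕ mulX (a · mulX f))
    ≈⟨ ⊕-congʳ (mulOnePlusX² f) (≋-trans (⊕-congˡ _ (mulOnePlusX²-mulX (deriv f)))
                                          (≋-sym (mulX-⊕ (mulOnePlusX² (deriv f)) (a · mulX f)))) ⟩
  mulOnePlusX² f ⊕ mulX (𝒟 a f) ∎
  where open ≋-Reasoning

𝒟-powSum : ∀ a β n → 𝒟 a (powSum β n) ≋ mulX (powSum (λ j → (a + + (2 N.* j)) * β j) n)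
𝒟-powSum a β n = begin
  mulOnePlusX² (deriv (powSum β n)) ⊕ (a · mulX (powSum β n))
    ≈⟨ ⊕-cong (mulOnePlusX²-deriv-powSum β n) (≋-sym (mulX-· a (powSum β n))) ⟩
  mulX (powSum (λ j → + (2 N.* j) * β j) n) ⊕ mulX (a · powSum β n)
    ≈⟨ mulX-⊕ _ _ ⟨
  mulX (powSum (λ j → + (2 N.* j) * β j) n ⊕ (a · powSum β n))
    ≈⟨ mulX-cong (≋-trans (⊕-congʳ (powSum (λ j → + (2 N.* j) * β j) n) (powSum-· a β n))
                          (powSum-⊕ (λ j → + (2 N.* j) * β j) (λ j → a * β j) n)) ⟩
  mulX (powSum (λ j → + (2 N.* j) * β j + a * β j) n)
    ≈⟨ mulX-cong (powSum-cong n (λ j → collect (+ (2 N.* j)) a (β j))) ⟩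
  mulX (powSum (λ j → (a + + (2 N.* j)) * β j) n) ∎
  where
  open ≋-Reasoning
  collect : ∀ t a b → t * b + a * b ≡ (a + t) * b
  collect = solve-∀

oddStepCoeff : ℤ → (ℕ → ℤ) → ℕ → ℤ
oddStepCoeff a β j = prev (λ i → (a + + suc (2 N.* i)) * β i) j - (a + + (2 N.* j)) * β j

𝒟-mulX-powSum : ∀ a β n → β (suc n) ≡ + 0 → 𝒟 a (mulX (powSum β n)) ≋ powSum (oddStepCoeff a β) (suc n)
𝒟-mulX-powSum a β n βₙ₊₁≡0 = begin
  𝒟 a (mulX (powSum β n))
    ≈⟨ 𝒟-mulX a (powSum β n) ⟩
  mulOnePlusX² (powSum β n) ⊕ mulX (𝒟 a (powSum β n))
    ≈⟨ ⊕-cong (mulOnePlusX²-powSum β n) (mulX-cong (𝒟-powSum a β n)) ⟩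
  powSum (prev β) (suc n) ⊕ mulX (mulX (powSum γ n))
    ≈⟨ ⊕-congʳ (powSum (prev β) (suc n)) (mulX²-powSum γ n γₙ₊₁≡0) ⟩
  powSum (prev β) (suc n) ⊕ powSum (λ j → prev γ j - γ j) (suc n)
    ≈⟨ powSum-⊕ (prev β) (λ j → prev γ j - γ j) (suc n) ⟩
  powSum (λ j → prev β j + (prev γ j - γ j)) (suc n)
    ≈⟨ powSum-cong (suc n) combine ⟩
  powSum (oddStepCoeff a β) (suc n) ∎
  where
  open ≋-Reasoning
  γ : ℕ → ℤ
  γ j = (a + + (2 N.* j)) * β j
  γₙ₊₁≡0 : γ (suc n) ≡ + 0
  γₙ₊₁≡0 = trans (cong (_*_ (a + + (2 N.* suc n))) βₙ₊₁≡0) (ZP.*-zeroʳ (a + + (2 N.* suc n)))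
  combine : ∀ j → prev β j + (prev γ j - γ j) ≡ oddStepCoeff a β j
  combine zero    = ZP.+-identityˡ _
  combine (suc i) = ring (β i) a (+ (2 N.* i)) (γ (suc i))
    where
    ring : ∀ b a t c → b + ((a + t) * b - c) ≡ (a + (+ 1 + t)) * b - c
    ring = solve-∀

U-zero : ∀ n → U n 0 ≡ 0
U-zero zero          = refl
U-zero (suc zero)    = refl
U-zero (suc (suc n)) = refl

U-vanish : ∀ n j → n < j → U n j ≡ 0
U-vanish zero          j             _         = refl
U-vanish (suc zero)    (suc zero)    (s≤s ())
U-vanish (suc zero)    (suc (suc j)) _         = refl
U-vanish (suc (suc n)) (suc j)       (s≤s n<j) =
  trans (cong₂ (λ a b → a N.+ (suc j N.* suc j) N.* b)
               (U-vanish (suc n) j n<j) (U-vanish (suc n) (suc j) (NP.m<n⇒m<1+n n<j)))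
        (NP.*-zeroʳ (suc j N.* suc j))

V-vanish : ∀ n j → n < j → V n j ≡ 0
V-vanish zero    (suc j) _         = refl
V-vanish (suc n) (suc j) (s≤s n<j) =
  trans (cong₂ (λ a b → a N.+ (suc (2 N.* suc j) N.* suc (2 N.* suc j)) N.* b)
               (V-vanish n j n<j) (V-vanish n (suc j) (NP.m<n⇒m<1+n n<j)))
        (NP.*-zeroʳ (suc (2 N.* suc j) N.* suc (2 N.* suc j)))

-- When n ≤ i truncated subtraction makes both exponents 0, hence the side condition on u.
^-∸-suc : ∀ r n i {u} → (n ≤ i → u ≡ 0) → r ^ (n ∸ i) * + u ≡ r * (r ^ (n ∸ suc i) * + u)
^-∸-suc r zero    i       u≡0 rewrite u≡0 z≤n =
  trans (ZP.*-zeroʳ (r ^ (0 ∸ i))) (sym (trans (cong (r *_) (ZP.*-zeroʳ (r ^ (0 ∸ suc i)))) (ZP.*-zeroʳ r)))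
^-∸-suc r (suc n) zero    {u} _ = ZP.*-assoc r (r ^ n) (+ u)
^-∸-suc r (suc n) (suc i) u≡0 = ^-∸-suc r n i (u≡0 ∘ s≤s)

factorial-absorb : ∀ k g u → + suc k * (g * (+ (k !) * u)) ≡ g * (+ (suc k !) * u)
factorial-absorb k g u = trans (x∙yz≈y∙xz (+ suc k) g (+ (k !) * u))
  (cong (g *_) (trans (sym (ZP.*-assoc (+ suc k) (+ (k !)) u))
                      (cong (_* u) (sym (ZP.pos-* (suc k) (k !))))))

+-recurrence : ∀ a b c → + (a N.+ (c N.* c) N.* b) ≡ + a + (+ c * + c) * + b
+-recurrence a b c = trans (ZP.pos-+ a _)
  (cong (_+_ (+ a)) (trans (ZP.pos-* (c N.* c) b) (cong (_* + b) (ZP.pos-* c c))))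

recurrence-step : ∀ {r w a} g g′ F u₀ u₁ → - (a * a) ≡ r * w → g * u₁ ≡ r * (g′ * u₁) →
  g * (F * u₀) - a * (g′ * ((a * F) * u₁)) ≡ g * (F * (u₀ + w * u₁))
recurrence-step {r} {w} {a} g g′ F u₀ u₁ -a²≡rw gu₁≡rg′u₁ = begin
  g * (F * u₀) - a * (g′ * ((a * F) * u₁))
    ≡⟨ solve (g ∷ g′ ∷ F ∷ u₀ ∷ u₁ ∷ a ∷ []) ⟩
  g * (F * u₀) + F * (- (a * a) * (g′ * u₁))
    ≡⟨ cong (λ t → g * (F * u₀) + F * (t * (g′ * u₁))) -a²≡rw ⟩
  g * (F * u₀) + F * ((r * w) * (g′ * u₁))
    ≡⟨ solve (g ∷ g′ ∷ F ∷ u₀ ∷ u₁ ∷ r ∷ w ∷ []) ⟩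
  g * (F * u₀) + F * (w * (r * (g′ * u₁)))
    ≡⟨ cong (λ t → g * (F * u₀) + F * (w * t)) gu₁≡rg′u₁ ⟨
  g * (F * u₀) + F * (w * (g * u₁))
    ≡⟨ solve (g ∷ F ∷ u₀ ∷ u₁ ∷ w ∷ []) ⟩
  g * (F * (u₀ + w * u₁)) ∎
  where open ≡-Reasoning

coeff-zero : ∀ g F {u} → u ≡ 0 → g * (F * + u) ≡ + 0
coeff-zero g F refl = trans (cong (g *_) (ZP.*-zeroʳ F)) (ZP.*-zeroʳ g)

tanOddCoeff tanEvenCoeff secEvenCoeff secOddCoeff : ℕ → ℕ → ℤ
tanOddCoeff  n j = (-4ℤ ^ (n ∸ j)) * (+ ((2 N.* j ∸ 1) !) * + U n j)
tanEvenCoeff n j = (-4ℤ ^ (n ∸ j)) * (+ ((2 N.* j) !) * + U n j)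
secEvenCoeff n j = (-1ℤ ^ (n ∸ j)) * (+ ((2 N.* j) !) * + V n j)
secOddCoeff  n j = (-1ℤ ^ (n ∸ j)) * (+ ((2 N.* j N.+ 1) !) * + V n j)

tan-even-coeff : ∀ n j → (+ 0 + + (2 N.* j)) * tanOddCoeff n j ≡ tanEvenCoeff n j
tan-even-coeff n zero    = sym (coeff-zero (-4ℤ ^ n) (+ 1) (U-zero n))
tan-even-coeff n (suc i) = factorial-absorb (2 N.* suc i ∸ 1) (-4ℤ ^ (n ∸ suc i)) (+ U n (suc i))

sec-odd-coeff : ∀ n j → (+ 1 + + (2 N.* j)) * secEvenCoeff n j ≡ secOddCoeff n j
sec-odd-coeff n j = trans (factorial-absorb (2 N.* j) (-1ℤ ^ (n ∸ j)) (+ V n j))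
  (cong (λ m → -1ℤ ^ (n ∸ j) * (+ (m !) * + V n j)) (NP.+-comm 1 (2 N.* j)))

tan-odd-coeff : ∀ n j → oddStepCoeff (+ 0) (tanEvenCoeff (suc n)) j ≡ tanOddCoeff (suc (suc n)) j
tan-odd-coeff n zero    = sym (ZP.*-zeroʳ (-4ℤ ^ suc (suc n)))
tan-odd-coeff n (suc i) = begin
  + suc (2 N.* i) * (g * (+ ((2 N.* i) !) * u₀)) - a * (g′ * (+ (suc k !) * u₁))
    ≡⟨ cong₂ _-_ (factorial-absorb (2 N.* i) g u₀)
                 (cong (λ f → a * (g′ * (f * u₁))) (ZP.pos-* (suc k) (k !))) ⟩
  g * (+ (suc (2 N.* i) !) * u₀) - a * (g′ * ((a * F) * u₁))
    ≡⟨ cong (λ m → g * (+ (m !) * u₀) - a * (g′ * ((a * F) * u₁))) (sym (NP.+-suc i (i N.+ 0))) ⟩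
  g * (F * u₀) - a * (g′ * ((a * F) * u₁))
    ≡⟨ recurrence-step {r = -4ℤ} {w = s * s} {a = a} g g′ F u₀ u₁ (four-squares s)
                       (^-∸-suc -4ℤ (suc n) i (U-vanish (suc n) (suc i) ∘ s≤s)) ⟩
  g * (F * (u₀ + (s * s) * u₁))
    ≡⟨ cong (λ v → g * (F * v)) (+-recurrence (U (suc n) i) (U (suc n) (suc i)) (suc i)) ⟨
  tanOddCoeff (suc (suc n)) (suc i) ∎
  where
  open ≡-Reasoning
  k : ℕ
  k = 2 N.* suc i ∸ 1
  s a F g g′ u₀ u₁ : ℤ
  s = + suc i
  a = + 2 * s
  F = + (k !)
  g = -4ℤ ^ (suc n ∸ i)
  g′ = -4ℤ ^ (suc n ∸ suc i)
  u₀ = + U (suc n) i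
  u₁ = + U (suc n) (suc i)
  four-squares : ∀ s → - ((+ 2 * s) * (+ 2 * s)) ≡ (- + 4) * (s * s)
  four-squares = solve-∀

sec-even-coeff : ∀ n j → oddStepCoeff (+ 1) (secOddCoeff n) j ≡ secEvenCoeff (suc n) j
sec-even-coeff n zero    = trans (negate (-1ℤ ^ n) (+ V n 0))
  (cong (λ m → -1ℤ ^ suc n * (+ 1 * + m)) (sym (NP.+-identityʳ (V n 0))))
  where
  negate : ∀ g v → + 0 - + 1 * (g * (+ 1 * v)) ≡ (- + 1 * g) * (+ 1 * v)
  negate = solve-∀
sec-even-coeff n (suc i) = begin
  + suc (suc (2 N.* i)) * (g * (+ ((2 N.* i N.+ 1) !) * v₀)) - a * (g′ * (+ ((k N.+ 1) !) * v₁))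
    ≡⟨ cong₂ (λ m m′ → + suc (suc (2 N.* i)) * (g * (+ (m !) * v₀)) - a * (g′ * (+ (m′ !) * v₁)))
             (NP.+-comm (2 N.* i) 1) (NP.+-comm k 1) ⟩
  + suc (suc (2 N.* i)) * (g * (+ (suc (2 N.* i) !) * v₀)) - a * (g′ * (+ (suc k !) * v₁))
    ≡⟨ cong₂ _-_ (factorial-absorb (suc (2 N.* i)) g v₀)
                 (cong (λ f → a * (g′ * (f * v₁))) (ZP.pos-* (suc k) (k !))) ⟩
  g * (+ (suc (suc (2 N.* i)) !) * v₀) - a * (g′ * ((a * F) * v₁))
    ≡⟨ cong (λ m → g * (+ (m !) * v₀) - a * (g′ * ((a * F) * v₁))) (sym (NP.*-suc 2 i)) ⟩
  g * (F * v₀) - a * (g′ * ((a * F) * v₁))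
    ≡⟨ recurrence-step {r = -1ℤ} {w = a * a} {a = a} g g′ F v₀ v₁ (sym (ZP.-1*i≡-i (a * a)))
                       (^-∸-suc -1ℤ n i (V-vanish n (suc i) ∘ s≤s)) ⟩
  g * (F * (v₀ + (a * a) * v₁))
    ≡⟨ cong (λ v → g * (F * v)) (+-recurrence (V n i) (V n (suc i)) (suc k)) ⟨
  secEvenCoeff (suc n) (suc i) ∎
  where
  open ≡-Reasoning
  k : ℕ
  k = 2 N.* suc i
  a F g g′ v₀ v₁ : ℤ
  a = + suc k
  F = + (k !)
  g = -1ℤ ^ (n ∸ i)
  g′ = -1ℤ ^ (n ∸ suc i)
  v₀ = + V n i
  v₁ = + V n (suc i)

Q-suc : ∀ k → Q (suc k) ≋ 𝒟 (+ 0) (Q k)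
Q-suc k i = trans (onePlusX²⊗≋mulOnePlusX² (deriv (Q k)) i) (sym (ZP.+-identityʳ _))

Q̂-suc : ∀ k → Q̂ (suc k) ≋ 𝒟 (+ 1) (Q̂ k)
Q̂-suc k = ⊕-cong (onePlusX²⊗≋mulOnePlusX² (deriv (Q̂ k)))
                 (λ i → trans (X⊗≋mulX (Q̂ k) i) (sym (ZP.*-identityˡ _)))

mutual
  tan-odd : ∀ m → Q (suc (2 N.* m)) ≋ powSum (tanOddCoeff (suc m)) (suc m)
  tan-odd zero = begin
    Q 1                            ≈⟨ onePlusX²⊗≋mulOnePlusX² (deriv X) ⟩
    mulOnePlusX² (deriv X)         ≈⟨ mulOnePlusX²-cong deriv-X ⟩
    mulOnePlusX² ((+ 1) · oneP)    ≈⟨ mulOnePlusX²-·^P (+ 1) 0 ⟩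
    (+ 1) · (onePlusX² ^P 1)       ≈⟨ (λ i → sym (ZP.+-identityˡ _)) ⟩
    powSum (tanOddCoeff 1) 1       ∎
    where
    open ≋-Reasoning
    deriv-X : deriv X ≋ (+ 1) · oneP
    deriv-X zero    = refl
    deriv-X (suc k) = ZP.*-zeroʳ (+ suc (suc k))
  tan-odd (suc m) = begin
    Q (suc (2 N.* suc m))
      ≈⟨ Q-suc (2 N.* suc m) ⟩
    𝒟 (+ 0) (Q (2 N.* suc m))
      ≈⟨ 𝒟-cong (+ 0) (tan-even m) ⟩
    𝒟 (+ 0) (mulX (powSum (tanEvenCoeff (suc m)) (suc m)))
      ≈⟨ 𝒟-mulX-powSum (+ 0) (tanEvenCoeff (suc m)) (suc m) top≡0 ⟩
    powSum (oddStepCoeff (+ 0) (tanEvenCoeff (suc m))) (suc (suc m))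
      ≈⟨ powSum-cong (suc (suc m)) (tan-odd-coeff m) ⟩
    powSum (tanOddCoeff (suc (suc m))) (suc (suc m)) ∎
    where
    open ≋-Reasoning
    top≡0 : tanEvenCoeff (suc m) (suc (suc m)) ≡ + 0
    top≡0 = coeff-zero (-4ℤ ^ (suc m ∸ suc (suc m))) (+ ((2 N.* suc (suc m)) !))
                       (U-vanish (suc m) (suc (suc m)) (NP.n<1+n (suc m)))

  tan-even : ∀ m → Q (2 N.* suc m) ≋ mulX (powSum (tanEvenCoeff (suc m)) (suc m))
  tan-even m = begin
    Q (2 N.* suc m)
      ≡⟨ cong Q (NP.*-suc 2 m) ⟩
    Q (suc (suc (2 N.* m)))
      ≈⟨ Q-suc (suc (2 N.* m)) ⟩
    𝒟 (+ 0) (Q (suc (2 N.* m)))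
      ≈⟨ 𝒟-cong (+ 0) (tan-odd m) ⟩
    𝒟 (+ 0) (powSum (tanOddCoeff (suc m)) (suc m))
      ≈⟨ 𝒟-powSum (+ 0) (tanOddCoeff (suc m)) (suc m) ⟩
    mulX (powSum (λ j → (+ 0 + + (2 N.* j)) * tanOddCoeff (suc m) j) (suc m))
      ≈⟨ mulX-cong (powSum-cong (suc m) (tan-even-coeff (suc m))) ⟩
    mulX (powSum (tanEvenCoeff (suc m)) (suc m)) ∎
    where open ≋-Reasoning

mutual
  sec-even : ∀ n → Q̂ (2 N.* n) ≋ powSum (secEvenCoeff n) n
  sec-even zero i  = sym (ZP.*-identityˡ (oneP i))
  sec-even (suc n) = begin
    Q̂ (2 N.* suc n)
      ≡⟨ cong Q̂ (NP.*-suc 2 n) ⟩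
    Q̂ (suc (suc (2 N.* n)))
      ≈⟨ Q̂-suc (suc (2 N.* n)) ⟩
    𝒟 (+ 1) (Q̂ (suc (2 N.* n)))
      ≈⟨ 𝒟-cong (+ 1) (sec-odd n) ⟩
    𝒟 (+ 1) (mulX (powSum (secOddCoeff n) n))
      ≈⟨ 𝒟-mulX-powSum (+ 1) (secOddCoeff n) n top≡0 ⟩
    powSum (oddStepCoeff (+ 1) (secOddCoeff n)) (suc n)
      ≈⟨ powSum-cong (suc n) (sec-even-coeff n) ⟩
    powSum (secEvenCoeff (suc n)) (suc n) ∎
    where
    open ≋-Reasoning
    top≡0 : secOddCoeff n (suc n) ≡ + 0
    top≡0 = coeff-zero (-1ℤ ^ (n ∸ suc n)) (+ ((2 N.* suc n N.+ 1) !)) (V-vanish n (suc n) (NP.n<1+n n))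

  sec-odd : ∀ n → Q̂ (suc (2 N.* n)) ≋ mulX (powSum (secOddCoeff n) n)
  sec-odd n = begin
    Q̂ (suc (2 N.* n))
      ≈⟨ Q̂-suc (2 N.* n) ⟩
    𝒟 (+ 1) (Q̂ (2 N.* n))
      ≈⟨ 𝒟-cong (+ 1) (sec-even n) ⟩
    𝒟 (+ 1) (powSum (secEvenCoeff n) n)
      ≈⟨ 𝒟-powSum (+ 1) (secEvenCoeff n) n ⟩
    mulX (powSum (λ j → (+ 1 + + (2 N.* j)) * secEvenCoeff n j) n)
      ≈⟨ mulX-cong (powSum-cong n (sec-odd-coeff n)) ⟩
    mulX (powSum (secOddCoeff n) n) ∎
    where open ≋-Reasoning

sum₁≋sum₀ : ∀ n f → f 0 ≋ zeroP → sum₁ n f ≋ sum₀ n f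
sum₁≋sum₀ zero    f f₀≋0 = ≋-sym f₀≋0
sum₁≋sum₀ (suc n) f f₀≋0 = ⊕-congˡ (f (suc n)) (sum₁≋sum₀ n f f₀≋0)

theorem6 : ∀ (n : ℕ) → 1 ≤ n →
      (Q (2 N.* n ∸ 1) ≋ sum₁ n (λ j → ((-4ℤ ^ (n ∸ j)) * (+ ((2 N.* j ∸ 1) !) * + U n j)) · (onePlusX² ^P j)))
    × (Q (2 N.* n) ≋ X ⊗ sum₁ n (λ j → ((-4ℤ ^ (n ∸ j)) * (+ ((2 N.* j) !) * + U n j)) · (onePlusX² ^P j)))
    × (Q̂ (2 N.* n) ≋ sum₀ n (λ j → ((-1ℤ ^ (n ∸ j)) * (+ ((2 N.* j) !) * + V n j)) · (onePlusX² ^P j)))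
    × (Q̂ (2 N.* n N.+ 1) ≋ X ⊗ sum₀ n (λ j → ((-1ℤ ^ (n ∸ j)) * (+ ((2 N.* j N.+ 1) !) * + V n j)) · (onePlusX² ^P j)))
theorem6 zero    ()
theorem6 (suc m) _ = Q-odd , Q-even , sec-even (suc m) , Q̂-odd
  where
  open ≋-Reasoning
  constant-term-zero : ∀ F → (-4ℤ ^ suc m * (F * + U (suc m) 0)) · oneP ≋ zeroP
  constant-term-zero F i = cong (_* oneP i) (coeff-zero (-4ℤ ^ suc m) F (U-zero (suc m)))

  Q-odd : Q (2 N.* suc m ∸ 1) ≋ sum₁ (suc m) (λ j → tanOddCoeff (suc m) j · (onePlusX² ^P j))
  Q-odd = begin
    Q (2 N.* suc m ∸ 1)                  ≡⟨ cong (λ k → Q (k ∸ 1)) (NP.*-suc 2 m) ⟩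
    Q (suc (2 N.* m))                    ≈⟨ tan-odd m ⟩
    powSum (tanOddCoeff (suc m)) (suc m) ≈⟨ sum₁≋sum₀ (suc m) _ (constant-term-zero (+ 1)) ⟨
    sum₁ (suc m) (λ j → tanOddCoeff (suc m) j · (onePlusX² ^P j)) ∎

  Q-even : Q (2 N.* suc m) ≋ X ⊗ sum₁ (suc m) (λ j → tanEvenCoeff (suc m) j · (onePlusX² ^P j))
  Q-even = begin
    Q (2 N.* suc m)                              ≈⟨ tan-even m ⟩
    mulX (powSum (tanEvenCoeff (suc m)) (suc m)) ≈⟨ mulX-cong (sum₁≋sum₀ (suc m) _ (constant-term-zero (+ 1))) ⟨
    mulX (sum₁ (suc m) (λ j → tanEvenCoeff (suc m) j · (onePlusX² ^P j))) ≈⟨ X⊗≋mulX _ ⟨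
    X ⊗ sum₁ (suc m) (λ j → tanEvenCoeff (suc m) j · (onePlusX² ^P j)) ∎

  Q̂-odd : Q̂ (2 N.* suc m N.+ 1) ≋ X ⊗ powSum (secOddCoeff (suc m)) (suc m)
  Q̂-odd = begin
    Q̂ (2 N.* suc m N.+ 1)                       ≡⟨ cong Q̂ (NP.+-comm (2 N.* suc m) 1) ⟩
    Q̂ (suc (2 N.* suc m))                       ≈⟨ sec-odd (suc m) ⟩
    mulX (powSum (secOddCoeff (suc m)) (suc m)) ≈⟨ X⊗≋mulX _ ⟨
    X ⊗ powSum (secOddCoeff (suc m)) (suc m)    ∎
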